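{- For every integer $b\ge 3$, there exists an infinite family of graphs of tree-width $2b-1$ such that for each graph $G$ in the family, $D_{\Gamma(G)+1}(G)$ is not connected; and there exists an infinite family of $b$-partite graphs such that for each graph $G$ in the family, $D_{\Gamma(G)+1}(G)$ is not connected.
   Context: All graphs are finite, simple and undirected. A set $S\subseteq V(G)$ is a dominating set of $G$ if every vertex of $V(G)\setminus S$ is adjacent to a vertex of $S$; $\Gamma(G)$ denotes the maximum cardinality of a minimal (with respect to inclusion) dominating set of $G$. For a positive integer $k$, the $k$-dominating graph $D_k(G)$ has as vertices the dominating sets of $G$ of cardinality at most $k$, two such sets being adjacent iff their symmetric difference consists of exactly one vertex of $G$. A graph is $b$-partite if its vertex set can be partitioned into $b$ independent sets. -}

module Defs where

open import Data.Nat using (ℕ; zero; suc; _+_; _≤_)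
open import Data.Bool using (Bool; true; false)
open import Data.Fin using (Fin; zero; suc; inject₁; fromℕ)
open import Data.Fin.Subset using (Subset; _∈_; _∉_; _⊂_; ∣_∣; _∩_; _∪_; ∁)
open import Data.Product using (Σ; ∃; ∃-syntax; _×_; _,_)
open import Data.Sum using (_⊎_)
open import Data.Unit using (⊤)
open import Relation.Nullary using (¬_)
open import Relation.Binary.PropositionalEquality using (_≡_; _≢_)
open import Function.Definitions using (Injective)

record Graph (n : ℕ) : Set where
  field
    adj    : Fin n → Fin n → Bool
    sym    : ∀ u v → adj u v ≡ adj v u
    irrefl : ∀ v → adj v v ≡ false

open Graph public

Adj : ∀ {n} → Graph n → Fin n → Fin n → Set
Adj G u v = adj G u v ≡ true

data Walk {A : Set} (P : A → Set) (R : A → A → Set) : A → A → Set where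
  here : ∀ {x} → Walk P R x x
  step : ∀ {x y z} → R x y → P y → Walk P R y z → Walk P R x z

ConnectedOn : {A : Set} → (A → Set) → (A → A → Set) → Set
ConnectedOn {A} P R = ∀ (x y : A) → P x → P y → Walk P R x y

Dominating : ∀ {n} → Graph n → Subset n → Set
Dominating {n} G S = ∀ (v : Fin n) → v ∈ S ⊎ (∃[ u ] (u ∈ S × Adj G u v))

MinimalDominating : ∀ {n} → Graph n → Subset n → Set
MinimalDominating {n} G S =
  Dominating G S × (∀ (T : Subset n) → T ⊂ S → ¬ Dominating G T)

IsUpperDominationNumber : ∀ {n} → Graph n → ℕ → Set
IsUpperDominationNumber {n} G k =
  (∃[ S ] (MinimalDominating G S × ∣ S ∣ ≡ k))
  × (∀ (S : Subset n) → MinimalDominating G S → ∣ S ∣ ≤ k)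

DkVertex : ∀ {n} → Graph n → ℕ → Subset n → Set
DkVertex G k S = Dominating G S × ∣ S ∣ ≤ k

symDiff : ∀ {n} → Subset n → Subset n → Subset n
symDiff S T = (S ∩ ∁ T) ∪ (T ∩ ∁ S)

DkAdj : ∀ {n} → Subset n → Subset n → Set
DkAdj S T = ∣ symDiff S T ∣ ≡ 1

DkConnected : ∀ {n} → Graph n → ℕ → Set
DkConnected G k = ConnectedOn (DkVertex G k) DkAdj

Partite : ∀ {n} → ℕ → Graph n → Set
Partite {n} b G =
  Σ (Fin n → Fin b) λ c → ∀ (u v : Fin n) → Adj G u v → c u ≢ c v

-- A cycle of length j+3: pairwise distinct vertices f 0, …, f (j+2),
-- consecutive ones adjacent, and the last adjacent to the first.
HasCycle : ∀ {m} → Graph m → Set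
HasCycle {m} T =
  ∃[ j ] Σ (Fin (suc (suc (suc j))) → Fin m) λ f →
    Injective _≡_ _≡_ f
    × (∀ (i : Fin (suc (suc j))) → Adj T (f (inject₁ i)) (f (suc i)))
    × Adj T (f (fromℕ (suc (suc j)))) (f zero)

IsTree : ∀ {m} → Graph m → Set
IsTree {m} T = ConnectedOn {Fin m} (λ _ → ⊤) (Adj T) × ¬ HasCycle T

record TreeDecomposition {n : ℕ} (G : Graph n) : Set where
  field
    m      : ℕ
    tree   : Graph (suc m)
    isTree : IsTree tree
    bag    : Fin (suc m) → Subset n
    covers-vertices : ∀ (v : Fin n) → ∃[ t ] (v ∈ bag t)
    covers-edges    : ∀ (u v : Fin n) → Adj G u v → ∃[ t ] (u ∈ bag t × v ∈ bag t)
    subtree         : ∀ (v : Fin n) →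
                        ConnectedOn (λ t → v ∈ bag t) (Adj tree)

open TreeDecomposition public

WidthAtMost : ∀ {n} {G : Graph n} → TreeDecomposition G → ℕ → Set
WidthAtMost D w = ∀ t → ∣ bag D t ∣ ≤ suc w

IsTreeWidth : ∀ {n} → Graph n → ℕ → Set
IsTreeWidth G w =
  (Σ (TreeDecomposition G) λ D → WidthAtMost D w)
  × (∀ (D : TreeDecomposition G) → ∀ w' → WidthAtMost D w' → w ≤ w')

-- A 9-vertex gadget F (three triangles) has Γ(F) = 3 with Γ-set S = {0,1,2}, another dominating
-- 3-set T missing 1 ∈ S, and S is rigid: a dominating set containing S - u but not u has at least
-- 4 vertices.  Let H have γ(H) = Γ(H) = h.  In D_{Γ+1}(F ⊕ H) = D_{4+h}(F ⊕ H), moving away from a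
-- set containing S can only delete one vertex, and deleting u ∈ S leaves at most 3 + h vertices, too
-- few to dominate F ⊕ H without u.  Hence S ∪ M and T ∪ M (M a Γ-set of H) lie in different
-- components.  For H = K_{2b} ⊕ (N isolated vertices) the tree-width is 2b - 1: a star decomposition
-- has width 2b - 1, and the clique lies in a single bag of every tree decomposition since following
-- the missing clique vertices from bag to bag would never backtrack, which a finite tree forbids.
-- For H = N isolated vertices the graph is b-partite, since F is 3-colourable.

module Submission where

open import Defs hiding (sym; m)
open import Data.Nat using (ℕ; zero; suc; _+_; _≤_; _<_; _*_; _∸_; z≤n; s≤s; s≤s⁻¹; _<?_; _≤?_)
open import Data.Nat.Properties
  using (≤-refl; ≤-trans; ≤-reflexive; <-trans; <-irrefl; n≮n; <-cmp; n≤1+n; n<1+n; m≤n+m; +-mono-≤; +-monoʳ-<;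
         +-suc; +-identityʳ; *-monoʳ-≤; m≤n⇒m<n∨m≡n; m≤n⇒∃[o]m+o≡n)
import Data.Bool as Bool
open import Data.Bool using (Bool; true; false; not)
open import Data.Fin using (Fin; zero; suc; #_; toℕ; fromℕ; fromℕ<; inject₁; inject≤; _↑ˡ_; _↑ʳ_; splitAt)
open import Data.Fin.Properties
  using (all?; any?; ¬∀⟶∃¬; pigeonhole; toℕ<n; toℕ-fromℕ<; toℕ-injective; toℕ-inject₁; toℕ-fromℕ;
         splitAt-↑ˡ; splitAt-↑ʳ; ↑ˡ-injective; inject≤-injective)
  renaming (_≟_ to _≟ᶠ_)
open import Data.Fin.Subset using (Subset; _∈_; _∉_; _⊆_; _⊂_; ∣_∣; ⁅_⁆; ⊤; ⊥; _-_)
open import Data.Fin.Subset.Properties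
  using (_∈?_; anySubset?; ⊆-refl; ∉⊥; ∈⊤; ∣⊥∣≡0; ∣⊤∣≡n; ∣p∣≤n; x∈⁅x⁆; x∈⁅y⁆⇒x≡y; ∣⁅x⁆∣≡1; p⊆q⇒∣p∣≤∣q∣; p⊂q⇒∣p∣<∣q∣;
         x∈p∪q⁺; x∈p∩q⁺; x∉p⇒x∈∁p; x∈p⇒p-x⊂p; x∈p∧x≢y⇒x∈p-y)
import Data.Vec as Vec
open import Data.Vec using (Vec; []; _∷_; _++_; lookup; here; there)
open import Data.Product using (Σ; ∃-syntax; _×_; _,_; proj₁; proj₂)
open import Data.Sum using (_⊎_; inj₁; inj₂; [_,_]′)
import Data.Unit as Unit
open import Data.Unit using (tt)
open import Data.Empty using (⊥-elim)
open import Function.Definitions using (Injective)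
open import Relation.Binary using (tri<; tri≈; tri>)
open import Relation.Binary.Construct.Closure.ReflexiveTransitive using (Star; ε; _◅_; _◅◅_)
import Relation.Binary.Construct.Closure.ReflexiveTransitive as Star
open import Relation.Nullary using (¬_; Dec; yes; no; does)
open import Relation.Nullary.Decidable using (_×-dec_; _⊎-dec_; _→-dec_; ¬?; map′; decidable-stable; from-yes)
open import Relation.Binary.PropositionalEquality using (_≡_; _≢_; refl; sym; trans; cong; subst; subst₂)

-- Disjoint unions

variable
  m n : ℕ

data SumView (m n : ℕ) : Fin (m + n) → Set where
  inl : (i : Fin m) → SumView m n (i ↑ˡ n)
  inr : (j : Fin n) → SumView m n (m ↑ʳ j)

sumView : ∀ m n (x : Fin (m + n)) → SumView m n x
sumView zero    n x       = inr x
sumView (suc m) n zero    = inl zero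
sumView (suc m) n (suc x) with sumView m n x
... | inl i = inl (suc i)
... | inr j = inr j

∈-++⁺ˡ : ∀ {i : Fin m} {p : Subset m} (q : Subset n) → i ∈ p → i ↑ˡ n ∈ p ++ q
∈-++⁺ˡ q here      = here
∈-++⁺ˡ q (there h) = there (∈-++⁺ˡ q h)

∈-++⁻ˡ : ∀ {i : Fin m} (p : Subset m) {q : Subset n} → i ↑ˡ n ∈ p ++ q → i ∈ p
∈-++⁻ˡ {i = zero}  (_ ∷ p) here      = here
∈-++⁻ˡ {i = suc i} (_ ∷ p) (there h) = there (∈-++⁻ˡ p h)

∈-++⁺ʳ : ∀ {j : Fin n} (p : Subset m) {q : Subset n} → j ∈ q → m ↑ʳ j ∈ p ++ q
∈-++⁺ʳ []      h = h
∈-++⁺ʳ (_ ∷ p) h = there (∈-++⁺ʳ p h)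

∈-++⁻ʳ : ∀ {j : Fin n} (p : Subset m) {q : Subset n} → m ↑ʳ j ∈ p ++ q → j ∈ q
∈-++⁻ʳ []      h         = h
∈-++⁻ʳ (_ ∷ p) (there h) = ∈-++⁻ʳ p h

∣p++q∣≡∣p∣+∣q∣ : (p : Subset m) (q : Subset n) → ∣ p ++ q ∣ ≡ ∣ p ∣ + ∣ q ∣
∣p++q∣≡∣p∣+∣q∣ []          q = refl
∣p++q∣≡∣p∣+∣q∣ (true ∷ p)  q = cong suc (∣p++q∣≡∣p∣+∣q∣ p q)
∣p++q∣≡∣p∣+∣q∣ (false ∷ p) q = ∣p++q∣≡∣p∣+∣q∣ p q

∣⊥++p∣≡∣p∣ : (p : Subset n) → ∣ ⊥ {m} ++ p ∣ ≡ ∣ p ∣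
∣⊥++p∣≡∣p∣ {m = m} p = trans (∣p++q∣≡∣p∣+∣q∣ (⊥ {m}) p) (cong (_+ ∣ p ∣) (∣⊥∣≡0 m))

∣p++⊥∣≡∣p∣ : (p : Subset m) → ∣ p ++ ⊥ {n} ∣ ≡ ∣ p ∣
∣p++⊥∣≡∣p∣ {n = n} p = trans (∣p++q∣≡∣p∣+∣q∣ p (⊥ {n})) (trans (cong (∣ p ∣ +_) (∣⊥∣≡0 n)) (+-identityʳ ∣ p ∣))

++-mono-⊆ : ∀ {m n} {p p′ : Subset m} {q q′ : Subset n} → p ⊆ p′ → q ⊆ q′ → p ++ q ⊆ p′ ++ q′
++-mono-⊆ {m} {n} {p} {p′} p⊆p′ q⊆q′ {x} x∈ with sumView m n x
... | inl i = ∈-++⁺ˡ _ (p⊆p′ (∈-++⁻ˡ p x∈))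
... | inr j = ∈-++⁺ʳ p′ (q⊆q′ (∈-++⁻ʳ p x∈))

++-⊆⁻ˡ : ∀ {p p′ : Subset m} {q q′ : Subset n} → p ++ q ⊆ p′ ++ q′ → p ⊆ p′
++-⊆⁻ˡ {p′ = p′} ⊆′ i∈ = ∈-++⁻ˡ p′ (⊆′ (∈-++⁺ˡ _ i∈))

++-⊆⁻ʳ : ∀ {p p′ : Subset m} {q q′ : Subset n} → p ++ q ⊆ p′ ++ q′ → q ⊆ q′
++-⊆⁻ʳ {p = p} {p′} ⊆′ j∈ = ∈-++⁻ʳ p′ (⊆′ (∈-++⁺ʳ p j∈))

infixr 5 _⊕_

_⊕_ : ∀ {m n} → Graph m → Graph n → Graph (m + n)
_⊕_ {m} {n} A B = record { adj = adj⊕ ; sym = sym⊕ ; irrefl = irrefl⊕ }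
  where
  adj⊕ : Fin (m + n) → Fin (m + n) → Bool
  adj⊕ u v with splitAt m u | splitAt m v
  ... | inj₁ i | inj₁ j = adj A i j
  ... | inj₂ i | inj₂ j = adj B i j
  ... | _      | _      = false

  sym⊕ : ∀ u v → adj⊕ u v ≡ adj⊕ v u
  sym⊕ u v with splitAt m u | splitAt m v
  ... | inj₁ i | inj₁ j = Graph.sym A i j
  ... | inj₁ _ | inj₂ _ = refl
  ... | inj₂ _ | inj₁ _ = refl
  ... | inj₂ i | inj₂ j = Graph.sym B i j

  irrefl⊕ : ∀ v → adj⊕ v v ≡ false
  irrefl⊕ v with splitAt m v
  ... | inj₁ i = irrefl A i
  ... | inj₂ j = irrefl B j

module _ {m n : ℕ} (A : Graph m) (B : Graph n) where

  adj-⊕ˡ : ∀ i j → adj (A ⊕ B) (i ↑ˡ n) (j ↑ˡ n) ≡ adj A i j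
  adj-⊕ˡ i j rewrite splitAt-↑ˡ m i n | splitAt-↑ˡ m j n = refl

  adj-⊕ʳ : ∀ i j → adj (A ⊕ B) (m ↑ʳ i) (m ↑ʳ j) ≡ adj B i j
  adj-⊕ʳ i j rewrite splitAt-↑ʳ m n i | splitAt-↑ʳ m n j = refl

  adj-⊕ˡʳ : ∀ i j → adj (A ⊕ B) (i ↑ˡ n) (m ↑ʳ j) ≡ false
  adj-⊕ˡʳ i j rewrite splitAt-↑ˡ m i n | splitAt-↑ʳ m n j = refl

  adj-⊕ʳˡ : ∀ i j → adj (A ⊕ B) (m ↑ʳ i) (j ↑ˡ n) ≡ false
  adj-⊕ʳˡ i j rewrite splitAt-↑ʳ m n i | splitAt-↑ˡ m j n = refl

  Adj-⊕ˡ⁺ : ∀ {i j} → Adj A i j → Adj (A ⊕ B) (i ↑ˡ n) (j ↑ˡ n)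
  Adj-⊕ˡ⁺ {i} {j} = trans (adj-⊕ˡ i j)

  Adj-⊕ˡ⁻ : ∀ {i j} → Adj (A ⊕ B) (i ↑ˡ n) (j ↑ˡ n) → Adj A i j
  Adj-⊕ˡ⁻ {i} {j} = trans (sym (adj-⊕ˡ i j))

  Adj-⊕ʳ⁺ : ∀ {i j} → Adj B i j → Adj (A ⊕ B) (m ↑ʳ i) (m ↑ʳ j)
  Adj-⊕ʳ⁺ {i} {j} = trans (adj-⊕ʳ i j)

  Adj-⊕ʳ⁻ : ∀ {i j} → Adj (A ⊕ B) (m ↑ʳ i) (m ↑ʳ j) → Adj B i j
  Adj-⊕ʳ⁻ {i} {j} = trans (sym (adj-⊕ʳ i j))

  ¬Adj-⊕ˡʳ : ∀ {i j} → ¬ Adj (A ⊕ B) (i ↑ˡ n) (m ↑ʳ j)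
  ¬Adj-⊕ˡʳ {i} {j} h with trans (sym h) (adj-⊕ˡʳ i j)
  ... | ()

  ¬Adj-⊕ʳˡ : ∀ {i j} → ¬ Adj (A ⊕ B) (m ↑ʳ i) (j ↑ˡ n)
  ¬Adj-⊕ʳˡ {i} {j} h with trans (sym h) (adj-⊕ʳˡ i j)
  ... | ()

-- Domination

Dominating-⊆ : ∀ (G : Graph n) {S T} → S ⊆ T → Dominating G S → Dominating G T
Dominating-⊆ G S⊆T d v with d v
... | inj₁ v∈S             = inj₁ (S⊆T v∈S)
... | inj₂ (u , u∈S , u~v) = inj₂ (u , S⊆T u∈S , u~v)

Dominating⇒nonempty : ∀ (G : Graph (suc n)) {X} → Dominating G X → ∃[ x ] x ∈ X
Dominating⇒nonempty G d with d zero
... | inj₁ 0∈X           = zero , 0∈X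
... | inj₂ (u , u∈X , _) = u , u∈X

DominationNumberAtLeast : Graph n → ℕ → Set
DominationNumberAtLeast {n} G h = ∀ (X : Subset n) → Dominating G X → h ≤ ∣ X ∣

DominationNumberAtLeast-1 : ∀ (G : Graph (suc n)) → DominationNumberAtLeast G 1
DominationNumberAtLeast-1 G X dX with Dominating⇒nonempty G dX
... | x , x∈X = subst (_≤ ∣ X ∣) (∣⁅x⁆∣≡1 x) (p⊆q⇒∣p∣≤∣q∣ (λ y∈ → subst (_∈ X) (sym (x∈⁅y⁆⇒x≡y x y∈)) x∈X))

module _ {m n : ℕ} (A : Graph m) (B : Graph n) where

  Dominating-⊕⁻ˡ : ∀ {p q} → Dominating (A ⊕ B) (p ++ q) → Dominating A p
  Dominating-⊕⁻ˡ {p} d i with d (i ↑ˡ n)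
  ... | inj₁ i∈ = inj₁ (∈-++⁻ˡ p i∈)
  ... | inj₂ (u , u∈ , u~i) with sumView m n u
  ...   | inl j = inj₂ (j , ∈-++⁻ˡ p u∈ , Adj-⊕ˡ⁻ A B u~i)
  ...   | inr j = ⊥-elim (¬Adj-⊕ʳˡ A B u~i)

  Dominating-⊕⁻ʳ : ∀ {p q} → Dominating (A ⊕ B) (p ++ q) → Dominating B q
  Dominating-⊕⁻ʳ {p} d j with d (m ↑ʳ j)
  ... | inj₁ j∈ = inj₁ (∈-++⁻ʳ p j∈)
  ... | inj₂ (u , u∈ , u~j) with sumView m n u
  ...   | inl i = ⊥-elim (¬Adj-⊕ˡʳ A B u~j)
  ...   | inr i = inj₂ (i , ∈-++⁻ʳ p u∈ , Adj-⊕ʳ⁻ A B u~j)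

  Dominating-⊕⁺ : ∀ {p q} → Dominating A p → Dominating B q → Dominating (A ⊕ B) (p ++ q)
  Dominating-⊕⁺ {p} {q} dA dB v with sumView m n v
  Dominating-⊕⁺ {p} {q} dA dB v | inl i with dA i
  ... | inj₁ i∈             = inj₁ (∈-++⁺ˡ q i∈)
  ... | inj₂ (u , u∈ , u~i) = inj₂ (u ↑ˡ n , ∈-++⁺ˡ q u∈ , Adj-⊕ˡ⁺ A B u~i)
  Dominating-⊕⁺ {p} {q} dA dB v | inr j with dB j
  ... | inj₁ j∈             = inj₁ (∈-++⁺ʳ p j∈)
  ... | inj₂ (u , u∈ , u~j) = inj₂ (m ↑ʳ u , ∈-++⁺ʳ p u∈ , Adj-⊕ʳ⁺ A B u~j)

  MinimalDominating-⊕⁻ˡ : ∀ {p q} → MinimalDominating (A ⊕ B) (p ++ q) → MinimalDominating A p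
  MinimalDominating-⊕⁻ˡ {p} {q} (d , minimal) =
    Dominating-⊕⁻ˡ d , λ T (T⊆p , x , x∈p , x∉T) dT →
      minimal (T ++ q) (++-mono-⊆ T⊆p ⊆-refl , x ↑ˡ n , ∈-++⁺ˡ q x∈p , λ x∈ → x∉T (∈-++⁻ˡ T x∈))
              (Dominating-⊕⁺ dT (Dominating-⊕⁻ʳ d))

  MinimalDominating-⊕⁻ʳ : ∀ {p q} → MinimalDominating (A ⊕ B) (p ++ q) → MinimalDominating B q
  MinimalDominating-⊕⁻ʳ {p} {q} (d , minimal) =
    Dominating-⊕⁻ʳ d , λ T (T⊆q , x , x∈q , x∉T) dT →
      minimal (p ++ T) (++-mono-⊆ ⊆-refl T⊆q , m ↑ʳ x , ∈-++⁺ʳ p x∈q , λ x∈ → x∉T (∈-++⁻ʳ p x∈))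
              (Dominating-⊕⁺ (Dominating-⊕⁻ˡ d) dT)

  MinimalDominating-⊕⁺ : ∀ {p q} → MinimalDominating A p → MinimalDominating B q →
                         MinimalDominating (A ⊕ B) (p ++ q)
  MinimalDominating-⊕⁺ {p} {q} (dA , minimalA) (dB , minimalB) = Dominating-⊕⁺ dA dB , minimal
    where
    minimal : ∀ T → T ⊂ p ++ q → ¬ Dominating (A ⊕ B) T
    minimal T T⊂ dT with Vec.splitAt m T
    minimal _ (T⊆ , x , x∈ , x∉T) dT | T₁ , T₂ , refl with sumView m n x
    ... | inl i = minimalA T₁ (++-⊆⁻ˡ T⊆ , i , ∈-++⁻ˡ p x∈ , λ i∈ → x∉T (∈-++⁺ˡ T₂ i∈)) (Dominating-⊕⁻ˡ dT)
    ... | inr j = minimalB T₂ (++-⊆⁻ʳ T⊆ , j , ∈-++⁻ʳ p x∈ , λ j∈ → x∉T (∈-++⁺ʳ T₁ j∈)) (Dominating-⊕⁻ʳ dT)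

  IsUpperDominationNumber-⊕ : ∀ {a b} → IsUpperDominationNumber A a → IsUpperDominationNumber B b →
                              IsUpperDominationNumber (A ⊕ B) (a + b)
  IsUpperDominationNumber-⊕ ((SA , minA , refl) , boundA) ((SB , minB , refl) , boundB) =
    (SA ++ SB , MinimalDominating-⊕⁺ minA minB , ∣p++q∣≡∣p∣+∣q∣ SA SB) , bound
    where
    bound : ∀ S → MinimalDominating (A ⊕ B) S → ∣ S ∣ ≤ ∣ SA ∣ + ∣ SB ∣
    bound S minS with Vec.splitAt m S
    ... | p , q , refl rewrite ∣p++q∣≡∣p∣+∣q∣ p q =
      +-mono-≤ (boundA p (MinimalDominating-⊕⁻ˡ minS)) (boundB q (MinimalDominating-⊕⁻ʳ minS))

  DominationNumberAtLeast-⊕ : ∀ {a b} → DominationNumberAtLeast A a → DominationNumberAtLeast B b →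
                              DominationNumberAtLeast (A ⊕ B) (a + b)
  DominationNumberAtLeast-⊕ γA γB X dX with Vec.splitAt m X
  ... | p , q , refl rewrite ∣p++q∣≡∣p∣+∣q∣ p q =
    +-mono-≤ (γA p (Dominating-⊕⁻ˡ dX)) (γB q (Dominating-⊕⁻ʳ dX))

-- Rigid sets disconnect the k-dominating graph

∣p∣≡1⇒unique : ∀ {p : Subset n} → ∣ p ∣ ≡ 1 → ∀ {x y} → x ∈ p → y ∈ p → x ≡ y
∣p∣≡1⇒unique {p = p} ∣p∣≡1 {x} {y} x∈p y∈p with x ≟ᶠ y
... | yes x≡y = x≡y
... | no  x≢y = ⊥-elim (<-irrefl refl (subst₂ _<_ (∣⁅x⁆∣≡1 x) ∣p∣≡1 (p⊂q⇒∣p∣<∣q∣ ⁅x⁆⊂p)))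
  where
  ⁅x⁆⊂p : ⁅ x ⁆ ⊂ p
  ⁅x⁆⊂p = (λ z∈ → subst (_∈ p) (sym (x∈⁅y⁆⇒x≡y x z∈)) x∈p)
        , y , y∈p , λ y∈ → x≢y (sym (x∈⁅y⁆⇒x≡y x y∈))

∈-symDiff⁺ˡ : ∀ {X Y : Subset n} {x} → x ∈ X → x ∉ Y → x ∈ symDiff X Y
∈-symDiff⁺ˡ x∈X x∉Y = x∈p∪q⁺ (inj₁ (x∈p∩q⁺ (x∈X , x∉p⇒x∈∁p x∉Y)))

∈-symDiff⁺ʳ : ∀ {X Y : Subset n} {x} → x ∈ Y → x ∉ X → x ∈ symDiff X Y
∈-symDiff⁺ʳ x∈Y x∉X = x∈p∪q⁺ (inj₂ (x∈p∩q⁺ (x∈Y , x∉p⇒x∈∁p x∉X)))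

module _ {X Y : Subset n} (X~Y : DkAdj X Y) {x} (x∈X : x ∈ X) (x∉Y : x ∉ Y) where

  DkAdj-drop⇒⊂ : Y ⊂ X
  DkAdj-drop⇒⊂ = Y⊆X , x , x∈X , x∉Y
    where
    Y⊆X : Y ⊆ X
    Y⊆X {z} z∈Y with z ∈? X
    ... | yes z∈X = z∈X
    ... | no  z∉X = ⊥-elim (x∉Y (subst (_∈ Y) (∣p∣≡1⇒unique X~Y (∈-symDiff⁺ʳ z∈Y z∉X) (∈-symDiff⁺ˡ x∈X x∉Y)) z∈Y))

  DkAdj-drop⇒keeps : ∀ {z} → z ∈ X → z ≢ x → z ∈ Y
  DkAdj-drop⇒keeps {z} z∈X z≢x with z ∈? Y
  ... | yes z∈Y = z∈Y
  ... | no  z∉Y = ⊥-elim (z≢x (∣p∣≡1⇒unique X~Y (∈-symDiff⁺ˡ z∈X z∉Y) (∈-symDiff⁺ˡ x∈X x∉Y)))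

Rigid : Graph n → Subset n → ℕ → Set
Rigid {n} G S k = ∀ {u} → u ∈ S → ∀ (Y : Subset n) → (∀ {j} → j ∈ S → j ≢ u → j ∈ Y) → u ∉ Y →
                  Dominating G Y → k < ∣ Y ∣

module _ {a b} {G : Graph a} {H : Graph b} {S : Subset a} {k h : ℕ}
         (rigid : Rigid G S k) (γH≥h : DominationNumberAtLeast H h) where

  private
    Vertex : Subset (a + b) → Set
    Vertex = DkVertex (G ⊕ H) (suc (k + h))

    Contains-S : Subset (a + b) → Set
    Contains-S X = ∀ {i} → i ∈ S → i ↑ˡ b ∈ X

  -- Without u, the G-part of Y has more than k vertices by rigidity and the H-part at least h.
  rigid-⊕-forces : ∀ {Y u} → Dominating (G ⊕ H) Y → ∣ Y ∣ ≤ k + h → u ∈ S →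
                   (∀ {j} → j ∈ S → j ≢ u → j ↑ˡ b ∈ Y) → u ↑ˡ b ∈ Y
  rigid-⊕-forces {Y} {u} dY ∣Y∣≤ u∈S others with (u ↑ˡ b) ∈? Y
  ... | yes u∈Y = u∈Y
  ... | no  u∉Y with Vec.splitAt a Y
  ...   | p , q , refl = ⊥-elim (n≮n (k + h) (≤-trans (+-mono-≤ k<∣p∣ (γH≥h q (Dominating-⊕⁻ʳ G H dY))) ∣p∣+∣q∣≤))
    where
    k<∣p∣ : k < ∣ p ∣
    k<∣p∣ = rigid u∈S p (λ j∈S j≢u → ∈-++⁻ˡ p (others j∈S j≢u)) (λ u∈p → u∉Y (∈-++⁺ˡ q u∈p))
                  (Dominating-⊕⁻ˡ G H dY)
    ∣p∣+∣q∣≤ : ∣ p ∣ + ∣ q ∣ ≤ k + h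
    ∣p∣+∣q∣≤ = subst (_≤ k + h) (∣p++q∣≡∣p∣+∣q∣ p q) ∣Y∣≤

  -- Deleting i ∈ S would leave at most k + h vertices, which rigid-⊕-forces rules out.
  DkAdj-preserves-S : ∀ {X Y} → Vertex X → Vertex Y → DkAdj X Y → Contains-S X → Contains-S Y
  DkAdj-preserves-S {X} {Y} (_ , ∣X∣≤) (dY , _) X~Y S⊆X {i} i∈S with (i ↑ˡ b) ∈? Y
  ... | yes i∈Y = i∈Y
  ... | no  i∉Y = rigid-⊕-forces dY ∣Y∣≤ i∈S others
    where
    ∣Y∣≤ : ∣ Y ∣ ≤ k + h
    ∣Y∣≤ = s≤s⁻¹ (≤-trans (p⊂q⇒∣p∣<∣q∣ (DkAdj-drop⇒⊂ X~Y (S⊆X i∈S) i∉Y)) ∣X∣≤)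
    others : ∀ {j} → j ∈ S → j ≢ i → j ↑ˡ b ∈ Y
    others j∈S j≢i = DkAdj-drop⇒keeps X~Y (S⊆X i∈S) i∉Y (S⊆X j∈S) (λ eq → j≢i (↑ˡ-injective b _ _ eq))

  Walk-preserves-S : ∀ {X Y} → Vertex X → Walk Vertex DkAdj X Y → Contains-S X → Contains-S Y
  Walk-preserves-S vX here                = λ S⊆X → S⊆X
  Walk-preserves-S vX (step X~Z vZ Z⇝Y) S⊆X = Walk-preserves-S vZ Z⇝Y (DkAdj-preserves-S vX vZ X~Z S⊆X)

  rigid-⊕-disconnected : ∀ {T M u} → Dominating G S → ∣ S ∣ ≤ suc k → Dominating G T → ∣ T ∣ ≤ suc k →
                         u ∈ S → u ∉ T → Dominating H M → ∣ M ∣ ≤ h →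
                         ¬ DkConnected (G ⊕ H) (suc (k + h))
  rigid-⊕-disconnected {T} {M} dS ∣S∣≤ dT ∣T∣≤ u∈S u∉T dM ∣M∣≤ connected =
    u∉T (∈-++⁻ˡ T (Walk-preserves-S (vertex dS ∣S∣≤) (connected _ _ (vertex dS ∣S∣≤) (vertex dT ∣T∣≤))
                                    (∈-++⁺ˡ M) u∈S))
    where
    vertex : ∀ {U} → Dominating G U → ∣ U ∣ ≤ suc k → Vertex (U ++ M)
    vertex {U} dU ∣U∣≤ = Dominating-⊕⁺ G H dU dM
                       , subst (_≤ suc (k + h)) (sym (∣p++q∣≡∣p∣+∣q∣ U M)) (+-mono-≤ ∣U∣≤ ∣M∣≤)

-- Complete and edgeless graphs

complete : ∀ n → Graph n
complete n = record { adj = λ u v → not (does (u ≟ᶠ v)) ; sym = sym′ ; irrefl = irrefl′ }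
  where
  sym′ : ∀ (u v : Fin n) → not (does (u ≟ᶠ v)) ≡ not (does (v ≟ᶠ u))
  sym′ u v with u ≟ᶠ v | v ≟ᶠ u
  ... | yes _   | yes _   = refl
  ... | no  _   | no  _   = refl
  ... | yes u≡v | no  v≢u = ⊥-elim (v≢u (sym u≡v))
  ... | no  u≢v | yes v≡u = ⊥-elim (u≢v (sym v≡u))

  irrefl′ : ∀ (u : Fin n) → not (does (u ≟ᶠ u)) ≡ false
  irrefl′ u with u ≟ᶠ u
  ... | yes _   = refl
  ... | no  u≢u = ⊥-elim (u≢u refl)

complete-Adj : ∀ {u v : Fin n} → u ≢ v → Adj (complete n) u v
complete-Adj {u = u} {v} u≢v with u ≟ᶠ v
... | yes u≡v = ⊥-elim (u≢v u≡v)
... | no  _   = refl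

complete-Dominating-⁅x⁆ : ∀ (x : Fin n) → Dominating (complete n) ⁅ x ⁆
complete-Dominating-⁅x⁆ x v with x ≟ᶠ v
... | yes refl = inj₁ (x∈⁅x⁆ x)
... | no  x≢v  = inj₂ (x , x∈⁅x⁆ x , complete-Adj x≢v)

complete-Γ≡1 : ∀ n → IsUpperDominationNumber (complete (suc n)) 1
complete-Γ≡1 n = (⁅ zero ⁆ , (complete-Dominating-⁅x⁆ zero , minimal) , ∣⁅x⁆∣≡1 (zero {n})) , bound
  where
  K = complete (suc n)

  minimal : ∀ T → T ⊂ ⁅ zero ⁆ → ¬ Dominating K T
  minimal T (T⊆ , x , x∈ , x∉T) dT with Dominating⇒nonempty K dT
  ... | y , y∈T = x∉T (subst (_∈ T) (trans (x∈⁅y⁆⇒x≡y zero (T⊆ y∈T)) (sym (x∈⁅y⁆⇒x≡y zero x∈))) y∈T)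

  bound : ∀ M → MinimalDominating K M → ∣ M ∣ ≤ 1
  bound M (dM , minimalM) with Dominating⇒nonempty K dM
  ... | x , x∈M = subst (∣ M ∣ ≤_) (∣⁅x⁆∣≡1 x) (p⊆q⇒∣p∣≤∣q∣ M⊆⁅x⁆)
    where
    M⊆⁅x⁆ : M ⊆ ⁅ x ⁆
    M⊆⁅x⁆ {y} y∈M with y ≟ᶠ x
    ... | yes refl = x∈⁅x⁆ x
    ... | no  y≢x  = ⊥-elim (minimalM ⁅ x ⁆ ( (λ z∈ → subst (_∈ M) (sym (x∈⁅y⁆⇒x≡y x z∈)) x∈M)
                                             , y , y∈M , λ y∈ → y≢x (x∈⁅y⁆⇒x≡y x y∈))
                                      (complete-Dominating-⁅x⁆ x))

edgeless : ∀ n → Graph n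
edgeless n = record { adj = λ _ _ → false ; sym = λ _ _ → refl ; irrefl = λ _ → refl }

edgeless-Dominating⇒⊤ : ∀ {X} → Dominating (edgeless n) X → ∀ v → v ∈ X
edgeless-Dominating⇒⊤ d v with d v
... | inj₁ v∈X = v∈X

edgeless-Γ≡n : ∀ n → IsUpperDominationNumber (edgeless n) n
edgeless-Γ≡n n = (⊤ , ((λ _ → inj₁ ∈⊤) , minimal) , ∣⊤∣≡n n) , λ M _ → ∣p∣≤n M
  where
  minimal : ∀ T → T ⊂ ⊤ → ¬ Dominating (edgeless n) T
  minimal T (_ , x , _ , x∉T) dT = x∉T (edgeless-Dominating⇒⊤ dT x)

edgeless-γ≥n : ∀ n → DominationNumberAtLeast (edgeless n) n
edgeless-γ≥n n X dX = subst (_≤ ∣ X ∣) (∣⊤∣≡n n) (p⊆q⇒∣p∣≤∣q∣ {p = ⊤} (λ {v} _ → edgeless-Dominating⇒⊤ dX v))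

-- Colourings

Partite-⊕ : ∀ {b m n} {A : Graph m} {B : Graph n} → Partite b A → Partite b B → Partite b (A ⊕ B)
Partite-⊕ {b} {m} {n} {A} {B} (colourA , properA) (colourB , properB) = colour , proper
  where
  colour : Fin (m + n) → Fin b
  colour v = [ colourA , colourB ]′ (splitAt m v)

  colour-↑ˡ : ∀ i → colour (i ↑ˡ n) ≡ colourA i
  colour-↑ˡ i rewrite splitAt-↑ˡ m i n = refl

  colour-↑ʳ : ∀ j → colour (m ↑ʳ j) ≡ colourB j
  colour-↑ʳ j rewrite splitAt-↑ʳ m n j = refl

  proper : ∀ u v → Adj (A ⊕ B) u v → colour u ≢ colour v
  proper u v u~v with sumView m n u | sumView m n v
  ... | inl i | inl j = λ eq → properA i j (Adj-⊕ˡ⁻ A B u~v) (trans (sym (colour-↑ˡ i)) (trans eq (colour-↑ˡ j)))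
  ... | inl i | inr j = ⊥-elim (¬Adj-⊕ˡʳ A B u~v)
  ... | inr i | inl j = ⊥-elim (¬Adj-⊕ʳˡ A B u~v)
  ... | inr i | inr j = λ eq → properB i j (Adj-⊕ʳ⁻ A B u~v) (trans (sym (colour-↑ʳ i)) (trans eq (colour-↑ʳ j)))

Partite-≤ : ∀ {b b′ n} {G : Graph n} → b ≤ b′ → Partite b G → Partite b′ G
Partite-≤ b≤b′ (colour , proper) =
  (λ v → inject≤ (colour v) b≤b′) , λ u v u~v eq → proper u v u~v (inject≤-injective b≤b′ b≤b′ _ _ eq)

edgeless-Partite : ∀ n → Partite 1 (edgeless n)
edgeless-Partite n = (λ _ → zero) , λ _ _ ()

-- Decision procedures and the gadget

Dominating? : ∀ (G : Graph n) Y → Dec (Dominating G Y)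
Dominating? G Y = all? λ v → v ∈? Y ⊎-dec any? λ u → u ∈? Y ×-dec adj G u v Bool.≟ true

allSubset? : ∀ {P : Subset n → Set} → (∀ Y → Dec (P Y)) → Dec (∀ Y → P Y)
allSubset? P? = map′ (λ ∄¬P Y → decidable-stable (P? Y) (λ ¬PY → ∄¬P (Y , ¬PY)))
                     (λ ∀P (Y , ¬PY) → ¬PY (∀P Y))
                     (¬? (anySubset? λ Y → ¬? (P? Y)))

MinimalDominating? : ∀ (G : Graph n) S → Dec (MinimalDominating G S)
MinimalDominating? G S = map′ to from (Dominating? G S ×-dec all? λ i → i ∈? S →-dec ¬? (Dominating? G (S - i)))
  where
  to : Dominating G S × (∀ i → i ∈ S → ¬ Dominating G (S - i)) → MinimalDominating G S
  to (dS , irredundant) = dS , λ T (T⊆S , x , x∈S , x∉T) dT →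
    irredundant x x∈S (Dominating-⊆ G (λ z∈T → x∈p∧x≢y⇒x∈p-y (T⊆S z∈T) (λ { refl → x∉T z∈T })) dT)

  from : MinimalDominating G S → Dominating G S × (∀ i → i ∈ S → ¬ Dominating G (S - i))
  from (dS , minimal) = dS , λ i i∈S → minimal (S - i) (x∈p⇒p-x⊂p i∈S)

Rigid? : ∀ (G : Graph n) S k → Dec (Rigid G S k)
Rigid? G S k = map′ to from
  (all? λ u → u ∈? S →-dec allSubset? λ Y →
     (all? λ j → j ∈? S →-dec ¬? (j ≟ᶠ u) →-dec j ∈? Y) →-dec ¬? (u ∈? Y) →-dec Dominating? G Y →-dec k <? ∣ Y ∣)
  where
  Rigidᵉ : Set
  Rigidᵉ = ∀ u → u ∈ S → ∀ Y → (∀ j → j ∈ S → j ≢ u → j ∈ Y) → u ∉ Y → Dominating G Y → k < ∣ Y ∣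

  to : Rigidᵉ → Rigid G S k
  to rigid {u} u∈S Y others u∉Y dY = rigid u u∈S Y (λ j j∈S j≢u → others j∈S j≢u) u∉Y dY

  from : Rigid G S k → Rigidᵉ
  from rigid u u∈S Y others u∉Y dY = rigid u∈S Y (λ {j} → others j) u∉Y dY

-- Three disjoint triangles {0,1,2}, {3,5,8}, {4,6,7}; each vertex of the first is joined
-- to one vertex of each of the other two.
gadget : Graph 9
gadget = record { adj = adjacency ; sym = from-yes sym? ; irrefl = from-yes irrefl? }
  where
  matrix : Vec (Vec Bool 9) 9
  matrix = (false ∷ true  ∷ true  ∷ true  ∷ true  ∷ false ∷ false ∷ false ∷ false ∷ [])
         ∷ (true  ∷ false ∷ true  ∷ false ∷ false ∷ true  ∷ true  ∷ false ∷ false ∷ [])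
         ∷ (true  ∷ true  ∷ false ∷ false ∷ false ∷ false ∷ false ∷ true  ∷ true  ∷ [])
         ∷ (true  ∷ false ∷ false ∷ false ∷ false ∷ true  ∷ false ∷ false ∷ true  ∷ [])
         ∷ (true  ∷ false ∷ false ∷ false ∷ false ∷ false ∷ true  ∷ true  ∷ false ∷ [])
         ∷ (false ∷ true  ∷ false ∷ true  ∷ false ∷ false ∷ false ∷ false ∷ true  ∷ [])
         ∷ (false ∷ true  ∷ false ∷ false ∷ true  ∷ false ∷ false ∷ true  ∷ false ∷ [])
         ∷ (false ∷ false ∷ true  ∷ false ∷ true  ∷ false ∷ true  ∷ false ∷ false ∷ [])
         ∷ (false ∷ false ∷ true  ∷ true  ∷ false ∷ true  ∷ false ∷ false ∷ false ∷ [])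
         ∷ []

  adjacency : Fin 9 → Fin 9 → Bool
  adjacency u v = lookup (lookup matrix u) v

  sym? : Dec (∀ u v → adjacency u v ≡ adjacency v u)
  sym? = all? λ u → all? λ v → adjacency u v Bool.≟ adjacency v u

  irrefl? : Dec (∀ v → adjacency v v ≡ false)
  irrefl? = all? λ v → adjacency v v Bool.≟ false

gadget-S : Subset 9
gadget-S = true ∷ true ∷ true ∷ false ∷ false ∷ false ∷ false ∷ false ∷ false ∷ []

gadget-T : Subset 9
gadget-T = true ∷ false ∷ false ∷ true ∷ true ∷ false ∷ false ∷ false ∷ false ∷ []

gadget-Γ≡3 : IsUpperDominationNumber gadget 3
gadget-Γ≡3 = (gadget-S , from-yes (MinimalDominating? gadget gadget-S) , refl)
           , from-yes (allSubset? λ M → MinimalDominating? gadget M →-dec ∣ M ∣ ≤? 3)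

gadget-rigid : Rigid gadget gadget-S 3
gadget-rigid = from-yes (Rigid? gadget gadget-S 3)

gadget-S-Dominating : Dominating gadget gadget-S
gadget-S-Dominating = from-yes (Dominating? gadget gadget-S)

gadget-T-Dominating : Dominating gadget gadget-T
gadget-T-Dominating = from-yes (Dominating? gadget gadget-T)

gadget-Partite : Partite 3 gadget
gadget-Partite = colour , from-yes (all? λ u → all? λ v → (adj gadget u v Bool.≟ true) →-dec ¬? (colour u ≟ᶠ colour v))
  where
  colour : Fin 9 → Fin 3
  colour = lookup (# 0 ∷ # 1 ∷ # 2 ∷ # 1 ∷ # 1 ∷ # 2 ∷ # 2 ∷ # 0 ∷ # 0 ∷ [])

-- Bags of a width-5 tree decomposition of the gadget on a single edge.
gadget-bagA gadget-bagB : Subset 9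
gadget-bagA = true ∷ true ∷ true ∷ true ∷ false ∷ true ∷ false ∷ false ∷ true ∷ []
gadget-bagB = true ∷ true ∷ true ∷ false ∷ true ∷ false ∷ true ∷ true ∷ false ∷ []

gadget-bags-cover : ∀ g → g ∈ gadget-bagA ⊎ g ∈ gadget-bagB
gadget-bags-cover = from-yes (all? λ g → g ∈? gadget-bagA ⊎-dec g ∈? gadget-bagB)

gadget-bags-cover-edges : ∀ g h → Adj gadget g h →
                          (g ∈ gadget-bagA × h ∈ gadget-bagA) ⊎ (g ∈ gadget-bagB × h ∈ gadget-bagB)
gadget-bags-cover-edges = from-yes (all? λ g → all? λ h → (adj gadget g h Bool.≟ true) →-dec
                            ((g ∈? gadget-bagA ×-dec h ∈? gadget-bagA) ⊎-dec (g ∈? gadget-bagB ×-dec h ∈? gadget-bagB)))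

-- Cycles from non-backtracking closed walks

module _ {v : ℕ} (T : Graph v) where

  Adj⇒≢ : ∀ {x y} → Adj T x y → x ≢ y
  Adj⇒≢ {x} x~x refl with trans (sym x~x) (irrefl T x)
  ... | ()

  InjectiveBelow : (ℕ → Fin v) → ℕ → Set
  InjectiveBelow g c = ∀ {i i′} → i < i′ → i′ < c → g i ≢ g i′

  closed-sequence⇒HasCycle : (h : ℕ → Fin v) (L : ℕ) →
    (∀ {i} → i < suc L → Adj T (h i) (h (suc i))) →
    (∀ {i} → suc (suc i) ≤ suc L → h (suc (suc i)) ≢ h i) →
    h (suc L) ≡ h 0 → InjectiveBelow h (suc L) → HasCycle T
  closed-sequence⇒HasCycle h zero          adjacent _            closed _         =
    ⊥-elim (Adj⇒≢ (adjacent ≤-refl) (sym closed))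
  closed-sequence⇒HasCycle h (suc zero)    _        nonbacktrack closed _         =
    ⊥-elim (nonbacktrack ≤-refl closed)
  closed-sequence⇒HasCycle h (suc (suc j)) adjacent _            closed injective =
    j , f , f-injective , path , closing
    where
    f : Fin (suc (suc (suc j))) → Fin v
    f k = h (toℕ k)

    f-injective : ∀ {k k′} → f k ≡ f k′ → k ≡ k′
    f-injective {k} {k′} eq with <-cmp (toℕ k) (toℕ k′)
    ... | tri< k<k′ _ _ = ⊥-elim (injective k<k′ (toℕ<n k′) eq)
    ... | tri≈ _ k≡k′ _ = toℕ-injective k≡k′
    ... | tri> _ _ k>k′ = ⊥-elim (injective k>k′ (toℕ<n k) (sym eq))

    path : ∀ (i : Fin (suc (suc j))) → Adj T (f (inject₁ i)) (f (suc i))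
    path i rewrite toℕ-inject₁ i = adjacent (<-trans (toℕ<n i) ≤-refl)

    closing : Adj T (f (fromℕ (suc (suc j)))) (f zero)
    closing rewrite toℕ-fromℕ (suc (suc j)) = subst (Adj T _) closed (adjacent ≤-refl)

  RepeatAt : (ℕ → Fin v) → ℕ → Set
  RepeatAt g c = Σ (Fin c) λ a → g (toℕ a) ≡ g c

  InjectiveBelow-suc : ∀ {g c} → InjectiveBelow g c → ¬ RepeatAt g c → InjectiveBelow g (suc c)
  InjectiveBelow-suc {g} injective ¬repeat {i} i<i′ i′<1+c with m≤n⇒m<n∨m≡n (s≤s⁻¹ i′<1+c)
  ... | inj₁ i′<c = injective i<i′ i′<c
  ... | inj₂ refl = λ gi≡gi′ → ¬repeat (fromℕ< i<i′ , trans (cong g (toℕ-fromℕ< i<i′)) gi≡gi′)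

  module _ (g : ℕ → Fin v) {c₀ : ℕ}
           (adjacent : ∀ {i} → i < c₀ → Adj T (g i) (g (suc i)))
           (nonbacktrack : ∀ {i} → suc (suc i) ≤ c₀ → g (suc (suc i)) ≢ g i) where

    first-repeat⇒HasCycle : ∀ {c} → c ≤ c₀ → InjectiveBelow g c → RepeatAt g c → HasCycle T
    first-repeat⇒HasCycle {c} c≤c₀ injective (a , ga≡gc) with m≤n⇒∃[o]m+o≡n (toℕ<n a)
    ... | L , a+1+L≡c = closed-sequence⇒HasCycle h L adjacent′ nonbacktrack′ closed injective′
      where
      a′ : ℕ
      a′ = toℕ a

      h : ℕ → Fin v
      h i = g (a′ + i)

      h-suc : ∀ i → h (suc i) ≡ g (suc (a′ + i))
      h-suc i = cong g (+-suc a′ i)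

      shift : ∀ {i} → i < suc L → a′ + i < c
      shift {i} i<1+L = subst (a′ + i <_) (trans (+-suc a′ L) a+1+L≡c) (+-monoʳ-< a′ i<1+L)

      adjacent′ : ∀ {i} → i < suc L → Adj T (h i) (h (suc i))
      adjacent′ {i} i<1+L = subst (Adj T (h i)) (sym (h-suc i)) (adjacent (≤-trans (shift i<1+L) c≤c₀))

      nonbacktrack′ : ∀ {i} → suc (suc i) ≤ suc L → h (suc (suc i)) ≢ h i
      nonbacktrack′ {i} 2+i≤1+L rewrite h-suc (suc i) | +-suc a′ i =
        nonbacktrack (≤-trans (subst (_< c) (+-suc a′ i) (shift 2+i≤1+L)) c≤c₀)

      closed : h (suc L) ≡ h 0
      closed = trans (h-suc L) (trans (cong g a+1+L≡c) (trans (sym ga≡gc) (cong g (sym (+-identityʳ a′)))))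

      injective′ : InjectiveBelow h (suc L)
      injective′ i<i′ i′<1+L = injective (+-monoʳ-< a′ i<i′) (shift i′<1+L)

    search-first-repeat : ∀ d {c} → d + c ≡ c₀ → InjectiveBelow g c → RepeatAt g c₀ → HasCycle T
    search-first-repeat zero    refl injective repeat = first-repeat⇒HasCycle ≤-refl injective repeat
    search-first-repeat (suc d) {c} d+c≡c₀ injective repeat with any? {n = c} (λ a → g (toℕ a) ≟ᶠ g c)
    ... | yes repeatᶜ = first-repeat⇒HasCycle (subst (c ≤_) d+c≡c₀ (m≤n+m c (suc d))) injective repeatᶜ
    ... | no ¬repeatᶜ = search-first-repeat d (trans (+-suc d c) d+c≡c₀) (InjectiveBelow-suc injective ¬repeatᶜ) repeat

    nonbacktracking-repeat⇒HasCycle : RepeatAt g c₀ → HasCycle T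
    nonbacktracking-repeat⇒HasCycle = search-first-repeat c₀ (+-identityʳ c₀) (λ _ ())

module _ {v : ℕ} {R : Fin v → Fin v → Set} where

  length : ∀ {a b} → Star R a b → ℕ
  length ε       = 0
  length (_ ◅ w) = suc (length w)

  -- The vertices of w in order, followed by e.
  visit : ∀ {a b} → Star R a b → Fin v → ℕ → Fin v
  visit {a} _       e zero    = a
  visit     ε       e (suc _) = e
  visit     (_ ◅ w) e (suc i) = visit w e i

  visit-length : ∀ {a b} (w : Star R a b) e → visit w e (length w) ≡ b
  visit-length ε       e = refl
  visit-length (_ ◅ w) e = visit-length w e

  visit-after : ∀ {a b} (w : Star R a b) e → visit w e (suc (length w)) ≡ e
  visit-after ε       e = refl
  visit-after (_ ◅ w) e = visit-after w e

  visit-Adj : ∀ (T : Graph v) → (∀ {x y} → R x y → Adj T x y) →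
              ∀ {a b} (w : Star R a b) e {i} → i < length w → Adj T (visit w e i) (visit w e (suc i))
  visit-Adj T R⇒Adj (r ◅ w) e {zero}  _       = R⇒Adj r
  visit-Adj T R⇒Adj (r ◅ w) e {suc i} 1+i<len = visit-Adj T R⇒Adj w e (s≤s⁻¹ 1+i<len)

  NonBacktracking : ∀ {a b} → Star R a b → Set
  NonBacktracking ε                          = Unit.⊤
  NonBacktracking (_ ◅ ε)                    = Unit.⊤
  NonBacktracking {a} (_ ◅ (_◅_ {j = z} r w)) = z ≢ a × NonBacktracking (r ◅ w)

  -- w followed by one more step to e does not backtrack.
  NonBacktrackingThen : ∀ {a b} → Star R a b → Fin v → Set
  NonBacktrackingThen ε                           e = Unit.⊤
  NonBacktrackingThen {a} (_ ◅ ε)                 e = e ≢ a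
  NonBacktrackingThen {a} (_ ◅ (_◅_ {j = z} r w)) e = z ≢ a × NonBacktrackingThen (r ◅ w) e

  NonBacktracking⇒Then : ∀ {a b e} → (∀ {x} → R x b → x ≢ e) →
                         (w : Star R a b) → NonBacktracking w → NonBacktrackingThen w e
  NonBacktracking⇒Then last≢e ε               _          = tt
  NonBacktracking⇒Then last≢e (r ◅ ε)         _          = λ e≡a → last≢e r (sym e≡a)
  NonBacktracking⇒Then last≢e (_ ◅ r ◅ w) (z≢a , nb) = z≢a , NonBacktracking⇒Then last≢e (r ◅ w) nb

  visit-nonbacktracking : ∀ {a b} (w : Star R a b) e → NonBacktrackingThen w e →
                          ∀ {i} → suc (suc i) ≤ suc (length w) → visit w e (suc (suc i)) ≢ visit w e i
  visit-nonbacktracking ε           e _          {i}     (s≤s ())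
  visit-nonbacktracking (_ ◅ ε)     e e≢a        {zero}  _       = e≢a
  visit-nonbacktracking (_ ◅ ε)     e _          {suc i} (s≤s (s≤s ()))
  visit-nonbacktracking (_ ◅ r ◅ w) e (z≢a , _)  {zero}  _       = z≢a
  visit-nonbacktracking (_ ◅ r ◅ w) e (_ , nb)   {suc i} (s≤s 2+i≤len) = visit-nonbacktracking (r ◅ w) e nb 2+i≤len

  NonBacktracking-tail : ∀ {x y c} (r : R x y) (w : Star R y c) → NonBacktracking (r ◅ w) → NonBacktracking w
  NonBacktracking-tail _ ε       _        = tt
  NonBacktracking-tail _ (_ ◅ _) (_ , nb) = nb

  removeBacktracks : ∀ {a b} → Star R a b → Σ (Star R a b) NonBacktracking
  removeBacktracks ε = ε , tt
  removeBacktracks {a} (r ◅ w) with removeBacktracks w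
  ... | ε , _ = r ◅ ε , tt
  ... | _◅_ {j = z} r′ w′ , nb with z ≟ᶠ a
  ...   | yes refl = w′ , NonBacktracking-tail r′ w′ nb
  ...   | no  z≢a  = r ◅ r′ ◅ w′ , z≢a , nb

module _ {v : ℕ} (T : Graph v) where

  -- An edge of T other than {s, t}.
  AdjOffEdge : Fin v → Fin v → Fin v → Fin v → Set
  AdjOffEdge s t a b = Adj T a b × ((a ≢ t × b ≢ t) ⊎ (a ≢ s × b ≢ s))

  off-edge-walk⇒HasCycle : ∀ {s t} → Adj T t s → Star (AdjOffEdge s t) s t → HasCycle T
  off-edge-walk⇒HasCycle {s} {t} t~s w with removeBacktracks w
  ... | w′ , nb = nonbacktracking-repeat⇒HasCycle T g adjacent
                    (visit-nonbacktracking w′ s (NonBacktracking⇒Then into-t w′ nb))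
                    (zero , sym (visit-after w′ s))
    where
    g : ℕ → Fin v
    g = visit w′ s

    into-t : ∀ {x} → AdjOffEdge s t x t → x ≢ s
    into-t (_ , inj₁ (_ , t≢t)) = ⊥-elim (t≢t refl)
    into-t (_ , inj₂ (x≢s , _)) = x≢s

    adjacent : ∀ {i} → i < suc (length w′) → Adj T (g i) (g (suc i))
    adjacent i<1+len with m≤n⇒m<n∨m≡n (s≤s⁻¹ i<1+len)
    ... | inj₁ i<len = visit-Adj T (λ (x~y , _) → x~y) w′ s i<len
    ... | inj₂ refl  = subst₂ (Adj T) (sym (visit-length w′ s)) (sym (visit-after w′ s)) t~s

-- Cliques in tree decompositions

Walk⇒Star : ∀ {A : Set} {P : A → Set} {R R′ : A → A → Set} → (∀ {x y} → P x → P y → R x y → R′ x y) →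
            ∀ {x y} → P x → Walk P R x y → Star R′ x y
Walk⇒Star f Px here             = ε
Walk⇒Star f Px (step r Py x⇝y) = f Px Py r ◅ Walk⇒Star f Py x⇝y

IsClique : ∀ {n} → Graph n → Subset n → Set
IsClique G K = ∀ {x y} → x ∈ K → y ∈ K → x ≢ y → Adj G x y

module _ {n} {G : Graph n} (D : TreeDecomposition G) where

  private
    V : Set
    V = Fin (suc (TreeDecomposition.m D))

    T : Graph (suc (TreeDecomposition.m D))
    T = tree D

  AdjAvoiding : V → V → V → Set
  AdjAvoiding t a b = Adj T a b × a ≢ t × b ≢ t

  AdjAvoiding-sym : ∀ {t a b} → AdjAvoiding t a b → AdjAvoiding t b a
  AdjAvoiding-sym (a~b , a≢t , b≢t) = trans (Graph.sym T _ _) a~b , b≢t , a≢t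

  lastExit : ∀ t {a r} → Star (Adj T) a r → r ≢ t →
             (a ≢ t × Star (AdjAvoiding t) a r) ⊎ (∃[ s ] (Adj T t s × Star (AdjAvoiding t) s r))
  lastExit t ε r≢t = inj₁ (r≢t , ε)
  lastExit t {a} (_◅_ {j = y} a~y w) r≢t with lastExit t w r≢t
  ... | inj₂ exit = inj₂ exit
  ... | inj₁ (y≢t , w′) with a ≟ᶠ t
  ...   | yes refl = inj₂ (y , a~y , w′)
  ...   | no  a≢t  = inj₁ (a≢t , (a~y , a≢t , y≢t) ◅ w′)

  avoiding-walk : ∀ {x a b t} → x ∉ bag D t → x ∈ bag D a → x ∈ bag D b → Star (AdjAvoiding t) a b
  avoiding-walk x∉t x∈a x∈b =
    Walk⇒Star (λ x∈p x∈q p~q → p~q , (λ { refl → x∉t x∈p }) , (λ { refl → x∉t x∈q })) x∈a (subtree D _ _ _ x∈a x∈b)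

  -- A vertex of K missing from bag t, and the first step from t towards a bag containing it.
  record Escape (K : Subset n) (t : V) : Set where
    field
      lost      : Fin n
      lost∈K    : lost ∈ K
      lost∉t    : lost ∉ bag D t
      next      : V
      t~next    : Adj T t next
      home      : V
      lost∈home : lost ∈ bag D home
      route     : Star (AdjAvoiding t) next home

  open Escape

  escape : ∀ {K} t {x} → x ∈ K → x ∉ bag D t → Escape K t
  escape t {x} x∈K x∉t with covers-vertices D x
  ... | r , x∈r with lastExit t (Walk⇒Star (λ _ _ p~q → p~q) tt (proj₁ (isTree D) t r tt tt)) (λ { refl → x∉t x∈r })
  ...   | inj₁ (t≢t , _)         = ⊥-elim (t≢t refl)
  ...   | inj₂ (s , t~s , route) = record { lost = x ; lost∈K = x∈K ; lost∉t = x∉t ; next = s ; t~next = t~s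
                                          ; home = r ; lost∈home = x∈r ; route = route }

  common-bag : ∀ {K x y r} → IsClique G K → x ∈ K → y ∈ K → x ∈ bag D r → ∃[ z ] (x ∈ bag D z × y ∈ bag D z)
  common-bag {x = x} {y} {r} clique x∈K y∈K x∈r with x ≟ᶠ y
  ... | yes refl = r , x∈r , x∈r
  ... | no  x≢y  = covers-edges D x y (clique x∈K y∈K x≢y)

  -- Two escapes that undo each other give a walk from s to t avoiding the edge {s, t}.
  escape-no-return : ∀ {K t} → IsClique G K → (e : Escape K t) (e′ : Escape K (next e)) → next e′ ≢ t
  escape-no-return {t = t} clique e e′ refl with common-bag clique (lost∈K e) (lost∈K e′) (lost∈home e)
  ... | z , x∈z , y∈z =
    proj₂ (isTree D) (off-edge-walk⇒HasCycle T (t~next e)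
      (Star.map avoids-t (route e) ◅◅ Star.map avoids-t (avoiding-walk (lost∉t e) (lost∈home e) x∈z) ◅◅
       Star.map avoids-s (avoiding-walk (lost∉t e′) y∈z (lost∈home e′)) ◅◅
       Star.map avoids-s (Star.reverse AdjAvoiding-sym (route e′))))
    where
    avoids-t : ∀ {a b} → AdjAvoiding t a b → AdjOffEdge T (next e) t a b
    avoids-t (a~b , a≢t , b≢t) = a~b , inj₁ (a≢t , b≢t)

    avoids-s : ∀ {a b} → AdjAvoiding (next e) a b → AdjOffEdge T (next e) t a b
    avoids-s (a~b , a≢s , b≢s) = a~b , inj₂ (a≢s , b≢s)

  escape-walk : ∀ {K} → (∀ t → Escape K t) → ℕ → V
  escape-walk escapeFrom zero    = zero
  escape-walk escapeFrom (suc i) = next (escapeFrom (escape-walk escapeFrom i))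

  escapes⇒HasCycle : ∀ {K} → IsClique G K → (∀ t → Escape K t) → HasCycle T
  escapes⇒HasCycle clique escapeFrom
    with pigeonhole (n<1+n _) (λ (k : Fin (suc (suc (TreeDecomposition.m D)))) → escape-walk escapeFrom (toℕ k))
  ... | i , j , i<j , walk-i≡walk-j =
    nonbacktracking-repeat⇒HasCycle T walk (λ _ → t~next (escapeFrom _))
      (λ _ → escape-no-return clique (escapeFrom _) (escapeFrom _))
      (fromℕ< i<j , trans (cong walk (toℕ-fromℕ< i<j)) walk-i≡walk-j)
    where
    walk : ℕ → V
    walk = escape-walk escapeFrom

  clique⊆bag : ∀ {K} → IsClique G K → ∃[ t ] K ⊆ bag D t
  clique⊆bag {K} clique with any? (λ t → all? λ x → x ∈? K →-dec x ∈? bag D t)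
  ... | yes (t , K⊆t) = t , λ {x} → K⊆t x
  ... | no  ¬K⊆bag    = ⊥-elim (proj₂ (isTree D) (escapes⇒HasCycle clique escapeFrom))
    where
    escapeFrom : ∀ t → Escape K t
    escapeFrom t with ¬∀⟶∃¬ n _ (λ x → x ∈? K →-dec x ∈? bag D t) (λ K⊆t → ¬K⊆bag (t , K⊆t))
    ... | x , x∉K∖t = escape t (decidable-stable (x ∈? K) (λ x∉K → x∉K∖t (λ x∈K → ⊥-elim (x∉K x∈K))))
                               (λ x∈t → x∉K∖t (λ _ → x∈t))

clique-size≤width : ∀ {n} {G : Graph n} {K} → IsClique G K → (D : TreeDecomposition G) →
                    ∀ w → WidthAtMost D w → ∣ K ∣ ≤ suc w
clique-size≤width clique D w width with clique⊆bag D clique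
... | t , K⊆t = ≤-trans (p⊆q⇒∣p∣≤∣q∣ K⊆t) (width t)

star : ∀ k → Graph (suc k)
star k = record { adj = adjacency ; sym = sym′ ; irrefl = λ { zero → refl ; (suc _) → refl } }
  where
  adjacency : Fin (suc k) → Fin (suc k) → Bool
  adjacency zero    zero    = false
  adjacency zero    (suc _) = true
  adjacency (suc _) zero    = true
  adjacency (suc _) (suc _) = false

  sym′ : ∀ u v → adjacency u v ≡ adjacency v u
  sym′ zero    zero    = refl
  sym′ zero    (suc _) = refl
  sym′ (suc _) zero    = refl
  sym′ (suc _) (suc _) = refl

star-Adj⇒centre : ∀ {k} {a b : Fin (suc k)} → Adj (star k) a b → a ≡ zero ⊎ b ≡ zero
star-Adj⇒centre {a = zero}              _ = inj₁ refl
star-Adj⇒centre {a = suc _} {b = zero}  _ = inj₂ refl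

star-cycle-centre : ∀ {k j} {f : Fin (suc (suc (suc j))) → Fin (suc k)} → Injective _≡_ _≡_ f →
                    Adj (star k) (f zero) (f (suc zero)) → Adj (star k) (f (suc zero)) (f (suc (suc zero))) →
                    f (suc zero) ≡ zero
star-cycle-centre injective f₀~f₁ f₁~f₂ with star-Adj⇒centre f₀~f₁ | star-Adj⇒centre f₁~f₂
... | _         | inj₁ f₁≡0 = f₁≡0
... | inj₂ f₁≡0 | inj₂ _    = f₁≡0
... | inj₁ f₀≡0 | inj₂ f₂≡0 with injective (trans f₀≡0 (sym f₂≡0))
...   | ()

-- The closing edge of the cycle meets the centre f 1 at neither of its ends.
star-acyclic : ∀ k → ¬ HasCycle (star k)
star-acyclic k (j , f , injective , path , closing)
  with star-cycle-centre injective (path zero) (path (suc zero)) | star-Adj⇒centre closing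
... | f₁≡0 | inj₁ fₗ≡0 with injective (trans fₗ≡0 (sym f₁≡0))
...   | ()
star-acyclic k (j , f , injective , path , closing) | f₁≡0 | inj₂ f₀≡0 with injective (trans f₀≡0 (sym f₁≡0))
...   | ()

star-isTree : ∀ k → IsTree (star k)
star-isTree k = connected , star-acyclic k
  where
  connected : ConnectedOn (λ _ → Unit.⊤) (Adj (star k))
  connected zero    zero    _ _ = here
  connected zero    (suc _) _ _ = step refl tt here
  connected (suc _) zero    _ _ = step refl tt here
  connected (suc _) (suc _) _ _ = step {y = zero} refl tt (step refl tt here)

-- The two families

DΓ+1-Disconnected : ∀ {n} → Graph n → Set
DΓ+1-Disconnected G = ∃[ k ] (IsUpperDominationNumber G k × ¬ DkConnected G (suc k))

-- T misses the vertex 1 of S.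
gadget⊕-DΓ+1-Disconnected : ∀ {n h} (H : Graph n) → IsUpperDominationNumber H h → DominationNumberAtLeast H h →
                            DΓ+1-Disconnected (gadget ⊕ H)
gadget⊕-DΓ+1-Disconnected H ΓH≡h@((M , (dM , _) , ∣M∣≡h) , _) γH≥h =
  _ , IsUpperDominationNumber-⊕ gadget H gadget-Γ≡3 ΓH≡h
    , rigid-⊕-disconnected gadget-rigid γH≥h gadget-S-Dominating (n≤1+n 3) gadget-T-Dominating (n≤1+n 3)
                           (there here) (λ { (there ()) }) dM (≤-reflexive ∣M∣≡h)

module TreeWidthFamily (c N : ℕ) (6≤1+c : 6 ≤ suc c) where

  H : Graph (suc c + N)
  H = complete (suc c) ⊕ edgeless N

  G : Graph (9 + (suc c + N))
  G = gadget ⊕ H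

  gadgetᵛ : Fin 9 → Fin (9 + (suc c + N))
  gadgetᵛ g = g ↑ˡ (suc c + N)

  cliqueᵛ : Fin (suc c) → Fin (9 + (suc c + N))
  cliqueᵛ k = 9 ↑ʳ (k ↑ˡ N)

  isolatedᵛ : Fin N → Fin (9 + (suc c + N))
  isolatedᵛ e = 9 ↑ʳ (suc c ↑ʳ e)

  -- A star whose centre holds one gadget bag, with leaves for the other gadget bag,
  -- the clique, and each isolated vertex.
  bags : Fin (suc (suc (suc N))) → Subset (9 + (suc c + N))
  bags zero                = gadget-bagA ++ ⊥
  bags (suc zero)          = gadget-bagB ++ ⊥
  bags (suc (suc zero))    = ⊥ {9} ++ (⊤ {suc c} ++ ⊥)
  bags (suc (suc (suc e))) = ⊥ {9} ++ (⊥ {suc c} ++ ⁅ e ⁆)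

  gadget∈bags⁻ : ∀ {g} t → gadgetᵛ g ∈ bags t →
                 (t ≡ zero × g ∈ gadget-bagA) ⊎ (t ≡ suc zero × g ∈ gadget-bagB)
  gadget∈bags⁻ zero                g∈ = inj₁ (refl , ∈-++⁻ˡ gadget-bagA g∈)
  gadget∈bags⁻ (suc zero)          g∈ = inj₂ (refl , ∈-++⁻ˡ gadget-bagB g∈)
  gadget∈bags⁻ (suc (suc zero))    g∈ = ⊥-elim (∉⊥ (∈-++⁻ˡ (⊥ {9}) g∈))
  gadget∈bags⁻ (suc (suc (suc _))) g∈ = ⊥-elim (∉⊥ (∈-++⁻ˡ (⊥ {9}) g∈))

  clique∈bags⁻ : ∀ {k} t → cliqueᵛ k ∈ bags t → t ≡ suc (suc zero)
  clique∈bags⁻ zero                k∈ = ⊥-elim (∉⊥ (∈-++⁻ʳ gadget-bagA k∈))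
  clique∈bags⁻ (suc zero)          k∈ = ⊥-elim (∉⊥ (∈-++⁻ʳ gadget-bagB k∈))
  clique∈bags⁻ (suc (suc zero))    k∈ = refl
  clique∈bags⁻ (suc (suc (suc _))) k∈ = ⊥-elim (∉⊥ (∈-++⁻ˡ (⊥ {suc c}) (∈-++⁻ʳ (⊥ {9}) k∈)))

  isolated∈bags⁻ : ∀ {e} t → isolatedᵛ e ∈ bags t → t ≡ suc (suc (suc e))
  isolated∈bags⁻ zero                e∈ = ⊥-elim (∉⊥ (∈-++⁻ʳ gadget-bagA e∈))
  isolated∈bags⁻ (suc zero)          e∈ = ⊥-elim (∉⊥ (∈-++⁻ʳ gadget-bagB e∈))
  isolated∈bags⁻ (suc (suc zero))    e∈ = ⊥-elim (∉⊥ (∈-++⁻ʳ (⊤ {suc c}) (∈-++⁻ʳ (⊥ {9}) e∈)))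
  isolated∈bags⁻ (suc (suc (suc i))) e∈ =
    cong (λ j → suc (suc (suc j))) (sym (x∈⁅y⁆⇒x≡y i (∈-++⁻ʳ (⊥ {suc c}) (∈-++⁻ʳ (⊥ {9}) e∈))))

  gadget∈bagA : ∀ {g} → g ∈ gadget-bagA → gadgetᵛ g ∈ bags zero
  gadget∈bagA = ∈-++⁺ˡ ⊥

  gadget∈bagB : ∀ {g} → g ∈ gadget-bagB → gadgetᵛ g ∈ bags (suc zero)
  gadget∈bagB = ∈-++⁺ˡ ⊥

  clique∈bag : ∀ k → cliqueᵛ k ∈ bags (suc (suc zero))
  clique∈bag k = ∈-++⁺ʳ (⊥ {9}) (∈-++⁺ˡ ⊥ ∈⊤)

  isolated∈bag : ∀ e → isolatedᵛ e ∈ bags (suc (suc (suc e)))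
  isolated∈bag e = ∈-++⁺ʳ (⊥ {9}) (∈-++⁺ʳ (⊥ {suc c}) (x∈⁅x⁆ e))

  subtree′ : ∀ v → ConnectedOn (λ t → v ∈ bags t) (Adj (star (suc (suc N))))
  subtree′ v t t′ v∈t v∈t′ with sumView 9 (suc c + N) v
  ... | inl g with gadget∈bags⁻ t v∈t | gadget∈bags⁻ t′ v∈t′
  ...   | inj₁ (refl , _) | inj₁ (refl , _) = here
  ...   | inj₁ (refl , _) | inj₂ (refl , _) = step refl v∈t′ here
  ...   | inj₂ (refl , _) | inj₁ (refl , _) = step refl v∈t′ here
  ...   | inj₂ (refl , _) | inj₂ (refl , _) = here
  subtree′ v t t′ v∈t v∈t′ | inr w with sumView (suc c) N w
  ... | inl k rewrite clique∈bags⁻ t v∈t | clique∈bags⁻ t′ v∈t′ = here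
  ... | inr e rewrite isolated∈bags⁻ t v∈t | isolated∈bags⁻ t′ v∈t′ = here

  covers-vertices′ : ∀ v → ∃[ t ] v ∈ bags t
  covers-vertices′ v with sumView 9 (suc c + N) v
  ... | inl g with gadget-bags-cover g
  ...   | inj₁ g∈A = zero , gadget∈bagA g∈A
  ...   | inj₂ g∈B = suc zero , gadget∈bagB g∈B
  covers-vertices′ v | inr w with sumView (suc c) N w
  ... | inl k = suc (suc zero) , clique∈bag k
  ... | inr e = suc (suc (suc e)) , isolated∈bag e

  covers-edges′ : ∀ u v → Adj G u v → ∃[ t ] (u ∈ bags t × v ∈ bags t)
  covers-edges′ u v u~v with sumView 9 (suc c + N) u | sumView 9 (suc c + N) v
  ... | inl g | inl g′ with gadget-bags-cover-edges g g′ (Adj-⊕ˡ⁻ gadget H {g} {g′} u~v)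
  ...   | inj₁ (g∈A , g′∈A) = zero , gadget∈bagA g∈A , gadget∈bagA g′∈A
  ...   | inj₂ (g∈B , g′∈B) = suc zero , gadget∈bagB g∈B , gadget∈bagB g′∈B
  covers-edges′ u v u~v | inl g | inr w = ⊥-elim (¬Adj-⊕ˡʳ gadget H {g} {w} u~v)
  covers-edges′ u v u~v | inr w | inl g = ⊥-elim (¬Adj-⊕ʳˡ gadget H {w} {g} u~v)
  covers-edges′ u v u~v | inr w | inr w′ with Adj-⊕ʳ⁻ gadget H {w} {w′} u~v
  ... | w~w′ with sumView (suc c) N w | sumView (suc c) N w′
  ...   | inl k | inl k′ = suc (suc zero) , clique∈bag k , clique∈bag k′
  ...   | inl k | inr e  = ⊥-elim (¬Adj-⊕ˡʳ (complete (suc c)) (edgeless N) {k} {e} w~w′)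
  ...   | inr e | inl k  = ⊥-elim (¬Adj-⊕ʳˡ (complete (suc c)) (edgeless N) {e} {k} w~w′)
  ...   | inr e | inr e′ with Adj-⊕ʳ⁻ (complete (suc c)) (edgeless N) {e} {e′} w~w′
  ...     | ()

  decomposition : TreeDecomposition G
  decomposition = record
    { m = suc (suc N) ; tree = star (suc (suc N)) ; isTree = star-isTree (suc (suc N)) ; bag = bags
    ; covers-vertices = covers-vertices′ ; covers-edges = covers-edges′ ; subtree = subtree′ }

  clique : Subset (9 + (suc c + N))
  clique = ⊥ {9} ++ (⊤ {suc c} ++ ⊥)

  ∣clique∣≡1+c : ∣ clique ∣ ≡ suc c
  ∣clique∣≡1+c = trans (∣p++⊥∣≡∣p∣ (⊤ {suc c})) (∣⊤∣≡n (suc c))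

  width : WidthAtMost decomposition c
  width zero                = ≤-trans (≤-reflexive (∣p++⊥∣≡∣p∣ {n = suc c + N} gadget-bagA)) 6≤1+c
  width (suc zero)          = ≤-trans (≤-reflexive (∣p++⊥∣≡∣p∣ {n = suc c + N} gadget-bagB)) 6≤1+c
  width (suc (suc zero))    = ≤-reflexive ∣clique∣≡1+c
  width (suc (suc (suc e))) =
    subst (_≤ suc c) (sym (trans (∣⊥++p∣≡∣p∣ {m = suc c} ⁅ e ⁆) (∣⁅x⁆∣≡1 e))) (s≤s z≤n)

  clique⁻ : ∀ {v} → v ∈ clique → ∃[ k ] v ≡ cliqueᵛ k
  clique⁻ {v} v∈ with sumView 9 (suc c + N) v
  ... | inl g = ⊥-elim (∉⊥ (∈-++⁻ˡ (⊥ {9}) v∈))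
  ... | inr w with sumView (suc c) N w
  ...   | inl k = k , refl
  ...   | inr e = ⊥-elim (∉⊥ (∈-++⁻ʳ (⊤ {suc c}) (∈-++⁻ʳ (⊥ {9}) v∈)))

  clique-IsClique : IsClique G clique
  clique-IsClique x∈ y∈ x≢y with clique⁻ x∈ | clique⁻ y∈
  ... | k , refl | k′ , refl =
    Adj-⊕ʳ⁺ gadget H {k ↑ˡ N} {k′ ↑ˡ N}
      (Adj-⊕ˡ⁺ (complete (suc c)) (edgeless N) {k} {k′} (complete-Adj {u = k} {k′} (λ { refl → x≢y refl })))

  treewidth : IsTreeWidth G c
  treewidth = (decomposition , width)
            , λ D w width′ → s≤s⁻¹ (subst (_≤ suc w) ∣clique∣≡1+c
                                          (clique-size≤width clique-IsClique D w width′))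

treewidth-family : ∀ b → 3 ≤ b → ∀ N →
                   ∃[ n ] (N ≤ n × Σ (Graph n) λ G → IsTreeWidth G (2 * b ∸ 1) × DΓ+1-Disconnected G)
treewidth-family b@(suc _) 3≤b N = _ , m≤n+m N _ , G , treewidth , gadget⊕-DΓ+1-Disconnected H ΓH≡1+N γH≥1+N
  where
  open TreeWidthFamily (2 * b ∸ 1) N (*-monoʳ-≤ 2 3≤b)

  ΓH≡1+N : IsUpperDominationNumber H (1 + N)
  ΓH≡1+N = IsUpperDominationNumber-⊕ (complete (2 * b)) (edgeless N) (complete-Γ≡1 _) (edgeless-Γ≡n N)

  γH≥1+N : DominationNumberAtLeast H (1 + N)
  γH≥1+N = DominationNumberAtLeast-⊕ (complete (2 * b)) (edgeless N)
             (DominationNumberAtLeast-1 (complete (2 * b))) (edgeless-γ≥n N)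

partite-family : ∀ b → 3 ≤ b → ∀ N →
                 ∃[ n ] (N ≤ n × Σ (Graph n) λ G → Partite b G × DΓ+1-Disconnected G)
partite-family b 3≤b N =
  _ , m≤n+m N 9 , gadget ⊕ edgeless N
    , Partite-⊕ (Partite-≤ {G = gadget} 3≤b gadget-Partite)
                (Partite-≤ {G = edgeless N} (≤-trans (s≤s z≤n) 3≤b) (edgeless-Partite N))
    , gadget⊕-DΓ+1-Disconnected (edgeless N) (edgeless-Γ≡n N) (edgeless-γ≥n N)

corollary2 : ∀ (b : ℕ) → 3 ≤ b →
    (∀ (N : ℕ) → ∃[ n ] (N ≤ n × Σ (Graph n) λ G →
        IsTreeWidth G (2 * b ∸ 1)
        × ∃[ k ] (IsUpperDominationNumber G k × ¬ DkConnected G (suc k))))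
    × (∀ (N : ℕ) → ∃[ n ] (N ≤ n × Σ (Graph n) λ G →
        Partite b G
        × ∃[ k ] (IsUpperDominationNumber G k × ¬ DkConnected G (suc k))))
corollary2 b 3≤b = treewidth-family b 3≤b , partite-family b 3≤b
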